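{- For every double-transposition $\alpha\in A_t$ and every even $k$ with $2\le k\le t/2$, there exist $\gamma_1,\ldots,\gamma_{\lceil\log_2 k\rceil}\in A_t$ such that $[[\cdots[[\alpha,\gamma_1],\gamma_2],\cdots],\gamma_{\lceil\log_2 k\rceil}]$ is a product of $k$ disjoint transpositions.
   Context: $A_t$ is the alternating group on $\{1,\ldots,t\}$. The commutator is $[\alpha,\gamma]=\alpha\gamma\alpha^{ -1}\gamma^{ -1}$. A double-transposition is a product of two disjoint transpositions. -}

module Defs where

open import Data.Nat using (ℕ; suc; _*_)
open import Data.Fin using (Fin)
open import Data.Product using (_×_; _,_; Σ; ∃)
open import Data.List using (List; length; concatMap)
open Data.List using () renaming ([] to []ᴸ; _∷_ to _∷ᴸ_)
open import Data.List.Relation.Unary.All as LAll using ()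
open import Data.List.Relation.Unary.Unique.Propositional using (Unique)
open import Data.Vec using (Vec; toList; []; _∷_)
open import Data.Nat.Divisibility using (_∣_)
open import Data.Fin.Permutation
  using (Permutation′; _⟨$⟩ʳ_; _≈_; id; flip; _∘ₚ_; transpose)
open import Relation.Binary.PropositionalEquality using (_≢_)

-- Permutations of {1,…,t}, modelled as bijections of Fin t.
Perm : ℕ → Set
Perm t = Permutation′ t

-- Product in the usual function-composition convention:
-- (σ · τ) x = σ (τ x).
infixl 7 _·_
_·_ : ∀ {t} → Perm t → Perm t → Perm t
σ · τ = τ ∘ₚ σ

_⁻¹ : ∀ {t} → Perm t → Perm t
σ ⁻¹ = flip σ

⟦_,_⟧ : ∀ {t} → Perm t → Perm t → Perm t
⟦ α , γ ⟧ = α · γ · α ⁻¹ · γ ⁻¹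

iterComm : ∀ {t m} → Perm t → Vec (Perm t) m → Perm t
iterComm α [] = α
iterComm α (γ ∷ γs) = iterComm ⟦ α , γ ⟧ γs

prodTransp : ∀ {t} → List (Fin t × Fin t) → Perm t
prodTransp []ᴸ = id
prodTransp ((a , b) ∷ᴸ ps) = transpose a b · prodTransp ps

points : ∀ {t} → List (Fin t × Fin t) → List (Fin t)
points = concatMap (λ { (a , b) → a ∷ᴸ b ∷ᴸ []ᴸ })

IsEvenPerm : ∀ {t} → Perm t → Set
IsEvenPerm {t} σ =
  Σ (List (Fin t × Fin t)) λ ps →
    LAll.All (λ { (a , b) → a ≢ b }) ps
    × (2 ∣ length ps)
    × (σ ≈ prodTransp ps)

IsDisjTranspProd : ∀ {t} → ℕ → Perm t → Set
IsDisjTranspProd {t} k σ =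
  Σ (Vec (Fin t × Fin t) k) λ ps →
    Unique (points (toList ps)) × (σ ≈ prodTransp (toList ps))

IsDoubleTransposition : ∀ {t} → Perm t → Set
IsDoubleTransposition = IsDisjTranspProd 2

module Submission where

-- Two identities on four distinct points drive the construction:
--   [(x y)(z w), (y z)(z w)] = (x w)(y z)   (a pair of transpositions is kept)
--   [(p q), (p f)(q g)]      = (p q)(f g)   (a transposition is doubled,
--                                            using two fresh points f, g).
-- They are checked by computation in Fin 4 and transported to Fin t along an
-- injective relabelling.  Since commutators of products of disjointly
-- supported permutations split into products of commutators, such blocks can
-- be applied side by side: one round doubles min(h, l ∸ h) of the current
-- h pairs of transpositions and keeps the rest.  Starting from h = 1 pair,
-- ⌈log₂ k⌉ rounds reach exactly l = q pairs, because q ≤ 2^⌈log₂ k⌉; the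
-- fresh points are the t ∸ 4 points not moved by α.

open import Defs
open import Data.Nat using (ℕ; _≤_; _*_)
open import Data.Nat.Divisibility using (_∣_)
open import Data.Nat.Logarithm using (⌈log₂_⌉)
open import Data.Product using (Σ; _×_)
open import Data.Vec using (Vec)
open import Data.Vec.Relation.Unary.All using (All)

open import Data.Fin using (Fin; zero; suc)
open import Data.Fin.Patterns using (0F; 1F; 2F; 3F)
import Data.Fin.Permutation.Components as PC
open import Data.Fin.Permutation using (_⟨$⟩ʳ_; _⟨$⟩ˡ_; _≈_; inverseˡ; inverseʳ)
open import Data.Fin.Properties using (_≟_; any?)
open import Data.List using (List; []; _∷_; _++_; map; length; filter; allFin)
open import Data.List.Membership.Propositional using (_∈_; _∉_)
open import Data.List.Membership.Propositional.Properties using (∈-filter⁺; ∈-filter⁻; ∈-allFin)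
open import Data.List.Properties using (length-++; length-tabulate; filter-accept; filter-reject; filter-all)
open import Data.List.Relation.Binary.Disjoint.Propositional using (Disjoint)
open import Data.List.Relation.Binary.Permutation.Propositional
  using (_↭_; ↭-sym; ↭⇒↭ₛ; module PermutationReasoning)
import Data.List.Relation.Binary.Permutation.Propositional.Properties as ↭
import Data.List.Relation.Binary.Permutation.Setoid.Properties as Permutationₛ
open import Data.List.Relation.Binary.Subset.Propositional using (_⊆_)
import Data.List.Relation.Binary.Subset.Propositional.Properties as Subset
open import Data.List.Relation.Unary.All using ([]; _∷_)
import Data.List.Relation.Unary.All as ListAll
import Data.List.Relation.Unary.All.Properties as ListAllₚ
open import Data.List.Relation.Unary.AllPairs using ([]; _∷_)
open import Data.List.Relation.Unary.Any using (here; there)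
open import Data.List.Relation.Unary.Unique.Propositional using (Unique)
import Data.List.Relation.Unary.Unique.Propositional.Properties as Unique
open import Data.Nat using (zero; suc; _+_; _∸_; _⊓_; _<_; _^_; z≤n; s≤s; ⌈_/2⌉)
open import Data.Nat.Divisibility using (divides; ∣m∣n⇒∣m+n)
open import Data.Nat.Induction using (<-wellFounded)
open import Data.Nat.Logarithm.Core using (⌈log2⌉)
open import Data.Nat.Properties
  using (≤-trans; ≤-antisym; suc-injective; +-identityʳ; *-identityˡ; *-identityʳ; *-comm; *-assoc; +-suc;
         *-suc; *-distribʳ-+; *-distribˡ-⊓; +-distribˡ-⊓; +-monoˡ-≤; +-monoʳ-≤; *-monoʳ-≤; *-monoˡ-≤;
         +-cancelˡ-≤; m⊓n≤m; m⊓n≤n; ⊓-glb; m+[n∸m]≡n; m≤m*n; m≤n*m; m^n≢0;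
         ⌊n/2⌋≤⌈n/2⌉; ⌊n/2⌋+⌈n/2⌉≡n; ⌈n/2⌉<n; module ≤-Reasoning)
open import Data.Nat.Tactic.RingSolver using (solve-∀)
open import Algebra.Properties.CommutativeSemigroup Data.Nat.Properties.+-commutativeSemigroup
  using (interchange)
open import Data.Product using (_,_; ∃; proj₁; proj₂)
import Data.Product as Product
import Data.Vec as V
open import Data.Vec.Properties using (toList∘fromList)
open import Data.Vec.Relation.Unary.All using ([]; _∷_)
open import Data.Vec.Relation.Unary.AllPairs using ([]; _∷_)
open import Data.Vec.Relation.Unary.Unique.Propositional.Properties using (lookup-injective)
open import Function using (_∘_)
open import Induction.WellFounded using (Acc; acc)
open import Relation.Binary.PropositionalEquality
open import Relation.Nullary using (yes; no; Dec; ¬?)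
open import Relation.Nullary.Decidable using (dec-true; dec-false)

-- n ≤ 2 ^ ⌈log₂ n⌉, by well-founded recursion along the definition of
-- ⌈log₂⌉: for n = 2 + n′ the logarithm is one more than that of 1 + ⌈n′/2⌉.
≤2^⌈log2⌉ : ∀ n (rec : Acc _<_ n) → n ≤ 2 ^ ⌈log2⌉ n rec
≤2^⌈log2⌉ zero _ = z≤n
≤2^⌈log2⌉ (suc zero) _ = s≤s z≤n
≤2^⌈log2⌉ (suc (suc n)) (acc rs) = begin
  2 + n                                         ≤⟨ s≤s (s≤s n≤2⌈n/2⌉) ⟩
  2 + 2 * ⌈ n /2⌉                               ≡⟨ sym (*-suc 2 ⌈ n /2⌉) ⟩
  2 * suc ⌈ n /2⌉                               ≤⟨ *-monoʳ-≤ 2 (≤2^⌈log2⌉ (suc ⌈ n /2⌉) (rs (⌈n/2⌉<n n))) ⟩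
  2 * 2 ^ ⌈log2⌉ (suc ⌈ n /2⌉) (rs (⌈n/2⌉<n n)) ∎
  where
  open ≤-Reasoning
  n≤2⌈n/2⌉ : n ≤ 2 * ⌈ n /2⌉
  n≤2⌈n/2⌉ = subst₂ _≤_ (⌊n/2⌋+⌈n/2⌉≡n n) (cong (⌈ n /2⌉ +_) (sym (+-identityʳ ⌈ n /2⌉)))
                    (+-monoˡ-≤ ⌈ n /2⌉ (⌊n/2⌋≤⌈n/2⌉ n))

n≤2^⌈log₂n⌉ : ∀ n → n ≤ 2 ^ ⌈log₂ n ⌉
n≤2^⌈log₂n⌉ n = ≤2^⌈log2⌉ n (<-wellFounded n)

half-positive : ∀ {q k} → k ≡ q * 2 → 2 ≤ k → 1 ≤ q
half-positive {zero} refl ()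
half-positive {suc _} _ _ = s≤s z≤n

sum-of-sums : ∀ {a a′} b c b′ c′ → a ≡ b + c → a′ ≡ b′ + c′ → a + a′ ≡ (b + b′) + (c + c′)
sum-of-sums b c b′ c′ a≡ a′≡ = trans (cong₂ _+_ a≡ a′≡) (interchange b c b′ c′)

split-pairs : ∀ {d h} → d ≤ h → h * 2 ≡ d * 2 + (h ∸ d) * 2
split-pairs {d} {h} d≤h = trans (cong (_* 2) (sym (m+[n∸m]≡n d≤h))) (*-distribʳ-+ 2 d (h ∸ d))

twice-factor : ∀ x h → 2 * x * h ≡ x * (h + h)
twice-factor = solve-∀

four-pairs : ∀ h d → h * 4 + d * 2 * 2 ≡ (h + d) * 4
four-pairs = solve-∀

four-pairs-+ : ∀ h d n → h * 4 + (d * 2 * 2 + n) ≡ (h + d) * 4 + n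
four-pairs-+ = solve-∀

-- Doubling min(h, l ∸ h) of h pairs halves the remaining ratio:
-- if h ≤ l ≤ 2^(m+1) h then l ≤ 2^m (h + min(h, l ∸ h)).
doubling-bound : ∀ m {h l} → h ≤ l → l ≤ 2 ^ suc m * h → l ≤ 2 ^ m * (h + h ⊓ (l ∸ h))
doubling-bound m {h} {l} h≤l l≤2^[1+m]h = begin
  l                                  ≤⟨ ⊓-glb (subst (l ≤_) (twice-factor (2 ^ m) h) l≤2^[1+m]h)
                                              (m≤n*m l (2 ^ m) {{m^n≢0 2 m}}) ⟩
  (2 ^ m * (h + h)) ⊓ (2 ^ m * l)    ≡⟨ sym (*-distribˡ-⊓ (2 ^ m) (h + h) l) ⟩
  2 ^ m * ((h + h) ⊓ l)              ≡⟨ cong (λ x → 2 ^ m * ((h + h) ⊓ x)) (sym (m+[n∸m]≡n h≤l)) ⟩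
  2 ^ m * ((h + h) ⊓ (h + (l ∸ h)))  ≡⟨ cong (2 ^ m *_) (sym (+-distribˡ-⊓ h h (l ∸ h))) ⟩
  2 ^ m * (h + h ⊓ (l ∸ h))          ∎
  where open ≤-Reasoning

-- Fresh-point budget l·4 ≤ h·4 + n (n free points, h current and l target
-- pairs): if h + d ≤ l, the 4d fresh points needed to double d pairs are
-- available, and afterwards the budget holds for h + d pairs.
budget-room : ∀ {h d l n} → h + d ≤ l → l * 4 ≤ h * 4 + n → d * 2 * 2 ≤ n
budget-room {h} {d} {l} {n} h+d≤l budget = +-cancelˡ-≤ (h * 4) _ _ (begin
  h * 4 + d * 2 * 2  ≡⟨ four-pairs h d ⟩
  (h + d) * 4        ≤⟨ *-monoˡ-≤ 4 h+d≤l ⟩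
  l * 4              ≤⟨ budget ⟩
  h * 4 + n          ∎)
  where open ≤-Reasoning

budget-next : ∀ {h d l n n′} → l * 4 ≤ h * 4 + n → n ≡ d * 2 * 2 + n′ → l * 4 ≤ (h + d) * 4 + n′
budget-next {h} {d} {l} {n} {n′} budget n≡ =
  subst (l * 4 ≤_) (trans (cong (h * 4 +_) n≡) (four-pairs-+ h d n′)) budget

module _ {A : Set} where

  Unique-++⁻ : (xs : List A) {ys : List A} → Unique (xs ++ ys) → Unique xs × Unique ys × Disjoint xs ys
  Unique-++⁻ [] unique = [] , unique , λ ()
  Unique-++⁻ (x ∷ xs) (x∉ ∷ unique) with Unique-++⁻ xs unique
  ... | uxs , uys , xs#ys =
    ListAllₚ.++⁻ˡ xs x∉ ∷ uxs , uys ,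
    λ { (here refl , v∈ys) → ListAll.lookup (ListAllₚ.++⁻ʳ xs x∉) v∈ys refl
      ; (there v∈xs , v∈ys) → xs#ys (v∈xs , v∈ys) }

  Unique-↭ : {xs ys : List A} → xs ↭ ys → Unique xs → Unique ys
  Unique-↭ xs↭ys = Permutationₛ.Unique-resp-↭ (setoid A) (↭⇒↭ₛ xs↭ys)

Pair : ℕ → Set
Pair t = Fin t × Fin t

module _ {t : ℕ} where

  transpose-matchˡ : (i j : Fin t) → PC.transpose i j i ≡ j
  transpose-matchˡ i j rewrite dec-true (i ≟ i) refl = refl

  transpose-matchʳ : (i j : Fin t) → PC.transpose i j j ≡ i
  transpose-matchʳ i j with j ≟ i
  ... | yes refl = refl
  ... | no _ rewrite dec-true (j ≟ j) refl = refl

  transpose-fix : {i j k : Fin t} → k ≢ i → k ≢ j → PC.transpose i j k ≡ k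
  transpose-fix {i} {j} {k} k≢i k≢j rewrite dec-false (k ≟ i) k≢i | dec-false (k ≟ j) k≢j = refl

  prodTransp-fix : (L : List (Pair t)) {x : Fin t} → x ∉ points L → prodTransp L ⟨$⟩ʳ x ≡ x
  prodTransp-fix [] _ = refl
  prodTransp-fix ((a , b) ∷ L) x∉ =
    trans (cong (PC.transpose a b) (prodTransp-fix L (x∉ ∘ there ∘ there)))
          (transpose-fix (x∉ ∘ here) (x∉ ∘ there ∘ here))

  prodTransp-++ : (A B : List (Pair t)) → prodTransp (A ++ B) ≈ prodTransp A · prodTransp B
  prodTransp-++ [] B x = refl
  prodTransp-++ ((a , b) ∷ A) B x = cong (PC.transpose a b) (prodTransp-++ A B x)

  points-++ : (A B : List (Pair t)) → points (A ++ B) ≡ points A ++ points B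
  points-++ [] B = refl
  points-++ ((a , b) ∷ A) B = cong (λ L → a ∷ b ∷ L) (points-++ A B)

-- Relabelling points along an injection e : Fin m → Fin t preserves
-- identities between products of transpositions.  This lets us verify
-- identities on four arbitrary points by computation in Fin 4.
module Relabel {m t : ℕ} (e : Fin m → Fin t) (e-inj : ∀ i j → e i ≡ e j → i ≡ j) where

  relabel : List (Pair m) → List (Pair t)
  relabel = map (Product.map e e)

  transpose-relabel : (i j k : Fin m) → PC.transpose (e i) (e j) (e k) ≡ e (PC.transpose i j k)
  transpose-relabel i j k = by-cases k (k ≟ i) (k ≟ j)
    where
    by-cases : ∀ k → Dec (k ≡ i) → Dec (k ≡ j) →
      PC.transpose (e i) (e j) (e k) ≡ e (PC.transpose i j k)
    by-cases .i (yes refl) _ =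
      trans (transpose-matchˡ (e i) (e j)) (cong e (sym (transpose-matchˡ i j)))
    by-cases .j (no _) (yes refl) =
      trans (transpose-matchʳ (e i) (e j)) (cong e (sym (transpose-matchʳ i j)))
    by-cases k (no k≢i) (no k≢j) =
      trans (transpose-fix (k≢i ∘ e-inj k i) (k≢j ∘ e-inj k j)) (cong e (sym (transpose-fix k≢i k≢j)))

  prodTransp-relabel : (L : List (Pair m)) (k : Fin m) →
    prodTransp (relabel L) ⟨$⟩ʳ e k ≡ e (prodTransp L ⟨$⟩ʳ k)
  prodTransp-relabel [] k = refl
  prodTransp-relabel ((a , b) ∷ L) k =
    trans (cong (PC.transpose (e a) (e b)) (prodTransp-relabel L k)) (transpose-relabel a b _)

  points-relabel : (L : List (Pair m)) {x : Fin t} → x ∈ points (relabel L) → ∃ λ k → e k ≡ x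
  points-relabel ((a , b) ∷ L) (here x≡ea) = a , sym x≡ea
  points-relabel ((a , b) ∷ L) (there (here x≡eb)) = b , sym x≡eb
  points-relabel ((a , b) ∷ L) (there (there x∈)) = points-relabel L x∈

  -- Inside the image of e both sides agree by prodTransp-relabel; outside
  -- it neither product moves the point.
  relabel-≈ : (L₁ L₂ : List (Pair m)) → prodTransp L₁ ≈ prodTransp L₂ →
    prodTransp (relabel L₁) ≈ prodTransp (relabel L₂)
  relabel-≈ L₁ L₂ L₁≈L₂ x with any? (λ k → e k ≟ x)
  ... | yes (k , refl) =
    trans (prodTransp-relabel L₁ k) (trans (cong e (L₁≈L₂ k)) (sym (prodTransp-relabel L₂ k)))
  ... | no x∉image =
    trans (prodTransp-fix (relabel L₁) (x∉image ∘ points-relabel L₁))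
          (sym (prodTransp-fix (relabel L₂) (x∉image ∘ points-relabel L₂)))

module _ {t : ℕ} where

  open import Data.List.Membership.DecPropositional (_≟_ {t}) using (_∈?_)

  ·-cong : {σ σ′ τ τ′ : Perm t} → σ ≈ σ′ → τ ≈ τ′ → σ · τ ≈ σ′ · τ′
  ·-cong {σ} σ≈σ′ τ≈τ′ x = trans (cong (σ ⟨$⟩ʳ_) (τ≈τ′ x)) (σ≈σ′ _)

  ⁻¹-cong : {σ σ′ : Perm t} → σ ≈ σ′ → σ ⁻¹ ≈ σ′ ⁻¹
  ⁻¹-cong {σ} {σ′} σ≈σ′ x =
    trans (cong (σ ⟨$⟩ˡ_) (sym (trans (σ≈σ′ (σ′ ⟨$⟩ˡ x)) (inverseʳ σ′)))) (inverseˡ σ)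

  ⟦⟧-cong : {σ σ′ τ τ′ : Perm t} → σ ≈ σ′ → τ ≈ τ′ → ⟦ σ , τ ⟧ ≈ ⟦ σ′ , τ′ ⟧
  ⟦⟧-cong {σ} {σ′} {τ} {τ′} σ≈σ′ τ≈τ′ =
    ·-cong {σ · τ · σ ⁻¹} {σ′ · τ′ · σ′ ⁻¹} {τ ⁻¹} {τ′ ⁻¹}
      (·-cong {σ · τ} {σ′ · τ′} {σ ⁻¹} {σ′ ⁻¹}
        (·-cong {σ} {σ′} {τ} {τ′} σ≈σ′ τ≈τ′) (⁻¹-cong {σ} {σ′} σ≈σ′))
      (⁻¹-cong {τ} {τ′} τ≈τ′)

  iterComm-cong : {σ σ′ : Perm t} {m : ℕ} (γs : Vec (Perm t) m) → σ ≈ σ′ →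
    iterComm σ γs ≈ iterComm σ′ γs
  iterComm-cong V.[] σ≈σ′ = σ≈σ′
  iterComm-cong {σ} {σ′} (γ V.∷ γs) σ≈σ′ =
    iterComm-cong γs (⟦⟧-cong {σ} {σ′} {γ} {γ} σ≈σ′ (λ _ → refl))

  IsDisjTranspProd-resp : {k : ℕ} {σ τ : Perm t} → σ ≈ τ → IsDisjTranspProd k τ → IsDisjTranspProd k σ
  IsDisjTranspProd-resp σ≈τ (ps , unique , τ≈ps) = ps , unique , λ x → trans (σ≈τ x) (τ≈ps x)

  SupportedOn : List (Fin t) → Perm t → Set
  SupportedOn R σ = ∀ x → x ∉ R → σ ⟨$⟩ʳ x ≡ x

  supported-⁻¹ : ∀ {R} σ → SupportedOn R σ → SupportedOn R (σ ⁻¹)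
  supported-⁻¹ σ fix x x∉R = trans (cong (σ ⟨$⟩ˡ_) (sym (fix x x∉R))) (inverseˡ σ)

  -- A permutation supported on R maps R into itself: if σ x left R, then
  -- σ would fix σ x, and injectivity would give σ x = x ∈ R.
  supported-∈ : ∀ {R} σ → SupportedOn R σ → ∀ {x} → x ∈ R → σ ⟨$⟩ʳ x ∈ R
  supported-∈ {R} σ fix {x} x∈R with (σ ⟨$⟩ʳ x) ∈? R
  ... | yes σx∈R = σx∈R
  ... | no σx∉R = subst (_∈ R) (sym σx≡x) x∈R
    where
    σx≡x : σ ⟨$⟩ʳ x ≡ x
    σx≡x = trans (sym (inverseˡ σ)) (trans (cong (σ ⟨$⟩ˡ_) (fix _ σx∉R)) (inverseˡ σ))

  supported-∉ : ∀ {B R} σ → SupportedOn R σ → Disjoint B R → ∀ {x} → x ∉ B → σ ⟨$⟩ʳ x ∉ B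
  supported-∉ {B} {R} σ fix B#R {x} x∉B with x ∈? R
  ... | yes x∈R = λ σx∈B → B#R (σx∈B , supported-∈ σ fix x∈R)
  ... | no x∉R = subst (_∉ B) (sym (fix x x∉R)) x∉B

  supported-commute : ∀ {B R} (σ τ : Perm t) → SupportedOn B σ → SupportedOn R τ → Disjoint B R →
    ∀ x → τ ⟨$⟩ʳ (σ ⟨$⟩ʳ x) ≡ σ ⟨$⟩ʳ (τ ⟨$⟩ʳ x)
  supported-commute {B} {R} σ τ fixσ fixτ B#R x with x ∈? B
  ... | yes x∈B =
    trans (fixτ _ (λ σx∈R → B#R (supported-∈ σ fixσ x∈B , σx∈R)))
          (cong (σ ⟨$⟩ʳ_) (sym (fixτ x (λ x∈R → B#R (x∈B , x∈R)))))
  ... | no x∉B =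
    trans (cong (τ ⟨$⟩ʳ_) (fixσ x x∉B)) (sym (fixσ _ (supported-∉ τ fixτ B#R x∉B)))

  -- Pointwise this is eight exchanges of letters supported on B and on R.
  ⟦⟧-disjoint : ∀ {B R} (β₁ γ₁ β₂ γ₂ : Perm t) →
    SupportedOn B β₁ → SupportedOn B γ₁ → SupportedOn R β₂ → SupportedOn R γ₂ → Disjoint B R →
    ⟦ β₁ · β₂ , γ₁ · γ₂ ⟧ ≈ ⟦ β₁ , γ₁ ⟧ · ⟦ β₂ , γ₂ ⟧
  ⟦⟧-disjoint {B} {R} β₁ γ₁ β₂ γ₂ sβ₁ sγ₁ sβ₂ sγ₂ B#R x = begin
    b₁ (b₂ (g₁ (g₂ (b₂⁻ (b₁⁻ (g₂⁻ (g₁⁻ x)))))))  ≡⟨ cong b₁ (swap γ₁ β₂ sγ₁ sβ₂ _) ⟩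
    b₁ (g₁ (b₂ (g₂ (b₂⁻ (b₁⁻ (g₂⁻ (g₁⁻ x)))))))  ≡⟨ cong (b₁ ∘ g₁ ∘ b₂ ∘ g₂) (swap (β₁ ⁻¹) (β₂ ⁻¹) sβ₁⁻ sβ₂⁻ _) ⟩
    b₁ (g₁ (b₂ (g₂ (b₁⁻ (b₂⁻ (g₂⁻ (g₁⁻ x)))))))  ≡⟨ cong (b₁ ∘ g₁ ∘ b₂) (swap (β₁ ⁻¹) γ₂ sβ₁⁻ sγ₂ _) ⟩
    b₁ (g₁ (b₂ (b₁⁻ (g₂ (b₂⁻ (g₂⁻ (g₁⁻ x)))))))  ≡⟨ cong (b₁ ∘ g₁) (swap (β₁ ⁻¹) β₂ sβ₁⁻ sβ₂ _) ⟩
    b₁ (g₁ (b₁⁻ (b₂ (g₂ (b₂⁻ (g₂⁻ (g₁⁻ x)))))))  ≡⟨ cong (b₁ ∘ g₁ ∘ b₁⁻ ∘ b₂ ∘ g₂ ∘ b₂⁻) (swap (γ₁ ⁻¹) (γ₂ ⁻¹) sγ₁⁻ sγ₂⁻ _) ⟩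
    b₁ (g₁ (b₁⁻ (b₂ (g₂ (b₂⁻ (g₁⁻ (g₂⁻ x)))))))  ≡⟨ cong (b₁ ∘ g₁ ∘ b₁⁻ ∘ b₂ ∘ g₂) (swap (γ₁ ⁻¹) (β₂ ⁻¹) sγ₁⁻ sβ₂⁻ _) ⟩
    b₁ (g₁ (b₁⁻ (b₂ (g₂ (g₁⁻ (b₂⁻ (g₂⁻ x)))))))  ≡⟨ cong (b₁ ∘ g₁ ∘ b₁⁻ ∘ b₂) (swap (γ₁ ⁻¹) γ₂ sγ₁⁻ sγ₂ _) ⟩
    b₁ (g₁ (b₁⁻ (b₂ (g₁⁻ (g₂ (b₂⁻ (g₂⁻ x)))))))  ≡⟨ cong (b₁ ∘ g₁ ∘ b₁⁻) (swap (γ₁ ⁻¹) β₂ sγ₁⁻ sβ₂ _) ⟩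
    b₁ (g₁ (b₁⁻ (g₁⁻ (b₂ (g₂ (b₂⁻ (g₂⁻ x)))))))  ∎
    where
    open ≡-Reasoning
    b₁ = β₁ ⟨$⟩ʳ_ ; b₁⁻ = β₁ ⟨$⟩ˡ_ ; g₁ = γ₁ ⟨$⟩ʳ_ ; g₁⁻ = γ₁ ⟨$⟩ˡ_
    b₂ = β₂ ⟨$⟩ʳ_ ; b₂⁻ = β₂ ⟨$⟩ˡ_ ; g₂ = γ₂ ⟨$⟩ʳ_ ; g₂⁻ = γ₂ ⟨$⟩ˡ_
    sβ₁⁻ = supported-⁻¹ β₁ sβ₁ ; sγ₁⁻ = supported-⁻¹ γ₁ sγ₁
    sβ₂⁻ = supported-⁻¹ β₂ sβ₂ ; sγ₂⁻ = supported-⁻¹ γ₂ sγ₂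
    swap : ∀ σ τ → SupportedOn B σ → SupportedOn R τ → ∀ y → τ ⟨$⟩ʳ (σ ⟨$⟩ʳ y) ≡ σ ⟨$⟩ʳ (τ ⟨$⟩ʳ y)
    swap σ τ sσ sτ = supported-commute σ τ sσ sτ B#R

  prodTransp-supported : {R : List (Fin t)} (L : List (Pair t)) → points L ⊆ R → SupportedOn R (prodTransp L)
  prodTransp-supported L L⊆R x x∉R = prodTransp-fix L (x∉R ∘ L⊆R)

  ⟦⟧-prodTransp-disjoint : {W₁ W₂ : List (Fin t)} (ps₁ γs₁ ps₂ γs₂ : List (Pair t)) →
    points ps₁ ⊆ W₁ → points γs₁ ⊆ W₁ → points ps₂ ⊆ W₂ → points γs₂ ⊆ W₂ → Disjoint W₁ W₂ →
    ⟦ prodTransp (ps₁ ++ ps₂) , prodTransp (γs₁ ++ γs₂) ⟧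
      ≈ ⟦ prodTransp ps₁ , prodTransp γs₁ ⟧ · ⟦ prodTransp ps₂ , prodTransp γs₂ ⟧
  ⟦⟧-prodTransp-disjoint ps₁ γs₁ ps₂ γs₂ ps₁⊆ γs₁⊆ ps₂⊆ γs₂⊆ W₁#W₂ x =
    trans (⟦⟧-cong {prodTransp (ps₁ ++ ps₂)} {β₁ · β₂} {prodTransp (γs₁ ++ γs₂)} {γ₁ · γ₂}
                   (prodTransp-++ ps₁ ps₂) (prodTransp-++ γs₁ γs₂) x)
          (⟦⟧-disjoint β₁ γ₁ β₂ γ₂ (prodTransp-supported ps₁ ps₁⊆) (prodTransp-supported γs₁ γs₁⊆)
                       (prodTransp-supported ps₂ ps₂⊆) (prodTransp-supported γs₂ γs₂⊆) W₁#W₂ x)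
    where
    β₁ = prodTransp ps₁ ; γ₁ = prodTransp γs₁
    β₂ = prodTransp ps₂ ; γ₂ = prodTransp γs₂

  four-injective : {a b c d : Fin t} → Unique (a ∷ b ∷ c ∷ d ∷ []) →
    let label = V.lookup (a V.∷ b V.∷ c V.∷ d V.∷ V.[]) in ∀ i j → label i ≡ label j → i ≡ j
  four-injective ((ab ∷ ac ∷ ad ∷ []) ∷ (bc ∷ bd ∷ []) ∷ (cd ∷ []) ∷ [] ∷ []) =
    lookup-injective ((ab ∷ ac ∷ ad ∷ []) ∷ (bc ∷ bd ∷ []) ∷ (cd ∷ []) ∷ [] ∷ [])

  -- In
  -- Fin 4 the commutator [∏ps, ∏γs] is the word ps, γs, then the reversed
  -- and flipped ps and γs, and both sides are compared by computation.
  module FourPoints (a b c d : Fin t) (distinct : Unique (a ∷ b ∷ c ∷ d ∷ [])) where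

    open Relabel (V.lookup (a V.∷ b V.∷ c V.∷ d V.∷ V.[])) (four-injective distinct) using (relabel-≈)

    keep-identity :
      ⟦ prodTransp ((a , b) ∷ (c , d) ∷ []) , prodTransp ((b , c) ∷ (c , d) ∷ []) ⟧
        ≈ prodTransp ((a , d) ∷ (b , c) ∷ [])
    keep-identity = relabel-≈
      ((0F , 1F) ∷ (2F , 3F) ∷ (1F , 2F) ∷ (2F , 3F) ∷ (3F , 2F) ∷ (1F , 0F) ∷ (3F , 2F) ∷ (2F , 1F) ∷ [])
      ((0F , 3F) ∷ (1F , 2F) ∷ [])
      (λ { 0F → refl ; 1F → refl ; 2F → refl ; 3F → refl })

    double-identity :
      ⟦ prodTransp ((a , b) ∷ []) , prodTransp ((a , c) ∷ (b , d) ∷ []) ⟧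
        ≈ prodTransp ((a , b) ∷ (c , d) ∷ [])
    double-identity = relabel-≈
      ((0F , 1F) ∷ (0F , 2F) ∷ (1F , 3F) ∷ (1F , 0F) ∷ (3F , 1F) ∷ (2F , 0F) ∷ [])
      ((0F , 1F) ∷ (2F , 3F) ∷ [])
      (λ { 0F → refl ; 1F → refl ; 2F → refl ; 3F → refl })

  Distinct : Pair t → Set
  Distinct (a , b) = a ≢ b

  EvenWord : List (Pair t) → Set
  EvenWord L = ListAll.All Distinct L × 2 ∣ length L

  even-perm : {L : List (Pair t)} → EvenWord L → IsEvenPerm (prodTransp L)
  even-perm {L} (distinct , even) = L , distinct , even , λ _ → refl

  even-++ : {A B : List (Pair t)} → EvenWord A → EvenWord B → EvenWord (A ++ B)
  even-++ {A} (dA , eA) (dB , eB) =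
    ListAllₚ.++⁺ dA dB , subst (2 ∣_) (sym (length-++ A)) (∣m∣n⇒∣m+n eA eB)

  -- A state (ps, F) consists of transpositions ps and free points F, all of
  -- the points points ps ++ F being distinct.  Joining two states only
  -- permutes their points.
  layout : (ps₁ ps₂ : List (Pair t)) (F₁ F₂ : List (Fin t)) →
    points (ps₁ ++ ps₂) ++ F₁ ++ F₂ ↭ (points ps₁ ++ F₁) ++ (points ps₂ ++ F₂)
  layout ps₁ ps₂ F₁ F₂ = begin
    points (ps₁ ++ ps₂) ++ F₁ ++ F₂   ≡⟨ cong (_++ F₁ ++ F₂) (points-++ ps₁ ps₂) ⟩
    (P₁ ++ P₂) ++ F₁ ++ F₂            ↭⟨ ↭.++-assoc P₁ P₂ (F₁ ++ F₂) ⟩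
    P₁ ++ P₂ ++ F₁ ++ F₂              ↭⟨ ↭.++⁺ˡ P₁ (↭.shifts P₂ F₁) ⟩
    P₁ ++ F₁ ++ P₂ ++ F₂              ↭⟨ ↭-sym (↭.++-assoc P₁ F₁ (P₂ ++ F₂)) ⟩
    (P₁ ++ F₁) ++ (P₂ ++ F₂)          ∎
    where
    open PermutationReasoning
    P₁ = points ps₁
    P₂ = points ps₂

  -- One round on the state (ps, F): an even γ = ∏γs with [∏ps, γ] = ∏qs,
  -- where qs consists of u more disjoint transpositions than ps and F′ are
  -- the free points left after 2u of them were used.
  record Round (ps : List (Pair t)) (F : List (Fin t)) (u : ℕ) : Set where
    field
      γs : List (Pair t)
      γs-even : EvenWord γs
      qs : List (Pair t)
      F′ : List (Fin t)
      commutator : ⟦ prodTransp ps , prodTransp γs ⟧ ≈ prodTransp qs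
      qs-length : length qs ≡ length ps + u
      F-length : length F ≡ u * 2 + length F′
      unique : Unique (points qs ++ F′)
      γs-inside : points γs ⊆ points ps ++ F
      result-inside : points qs ++ F′ ⊆ points ps ++ F

  idle-round : (F : List (Fin t)) → Unique F → Round [] F 0
  idle-round F unique = record
    { γs = [] ; γs-even = [] , divides 0 refl ; qs = [] ; F′ = F
    ; commutator = λ _ → refl ; qs-length = refl ; F-length = refl
    ; unique = unique ; γs-inside = λ () ; result-inside = λ x∈ → x∈ }

  all-∈⇒⊆ : {xs ys : List (Fin t)} → ListAll.All (_∈ ys) xs → xs ⊆ ys
  all-∈⇒⊆ = ListAll.lookup

  ∈₁ : {a b c d : Fin t} → a ∈ a ∷ b ∷ c ∷ d ∷ []
  ∈₁ = here refl

  ∈₂ : {a b c d : Fin t} → b ∈ a ∷ b ∷ c ∷ d ∷ []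
  ∈₂ = there (here refl)

  ∈₃ : {a b c d : Fin t} → c ∈ a ∷ b ∷ c ∷ d ∷ []
  ∈₃ = there (there (here refl))

  ∈₄ : {a b c d : Fin t} → d ∈ a ∷ b ∷ c ∷ d ∷ []
  ∈₄ = there (there (there (here refl)))

  keep-round : (x y z w : Fin t) → Unique (x ∷ y ∷ z ∷ w ∷ []) →
    Round ((x , y) ∷ (z , w) ∷ []) [] 0
  keep-round x y z w distinct@((x≢y ∷ x≢z ∷ x≢w ∷ []) ∷ (y≢z ∷ y≢w ∷ []) ∷ (z≢w ∷ []) ∷ [] ∷ []) = record
    { γs = (y , z) ∷ (z , w) ∷ [] ; γs-even = (y≢z ∷ z≢w ∷ []) , divides 1 refl
    ; qs = (x , w) ∷ (y , z) ∷ [] ; F′ = []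
    ; commutator = FourPoints.keep-identity x y z w distinct
    ; qs-length = refl ; F-length = refl
    ; unique = (x≢w ∷ x≢y ∷ x≢z ∷ []) ∷ ((y≢w ∘ sym) ∷ (z≢w ∘ sym) ∷ []) ∷ (y≢z ∷ []) ∷ [] ∷ []
    ; γs-inside = all-∈⇒⊆ (∈₂ ∷ ∈₃ ∷ ∈₃ ∷ ∈₄ ∷ [])
    ; result-inside = all-∈⇒⊆ (∈₁ ∷ ∈₄ ∷ ∈₂ ∷ ∈₃ ∷ []) }

  double-round : (p q f g : Fin t) → Unique (p ∷ q ∷ f ∷ g ∷ []) →
    Round ((p , q) ∷ []) (f ∷ g ∷ []) 1
  double-round p q f g distinct@((_ ∷ p≢f ∷ _ ∷ []) ∷ (_ ∷ q≢g ∷ []) ∷ _ ∷ [] ∷ []) = record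
    { γs = (p , f) ∷ (q , g) ∷ [] ; γs-even = (p≢f ∷ q≢g ∷ []) , divides 1 refl
    ; qs = (p , q) ∷ (f , g) ∷ [] ; F′ = []
    ; commutator = FourPoints.double-identity p q f g distinct
    ; qs-length = refl ; F-length = refl
    ; unique = distinct
    ; γs-inside = all-∈⇒⊆ (∈₁ ∷ ∈₃ ∷ ∈₂ ∷ ∈₄ ∷ [])
    ; result-inside = λ x∈ → x∈ }

  -- Rounds on two states with disjoint points run in parallel: the
  -- commutator splits by ⟦⟧-prodTransp-disjoint and all counts add up.
  combine : {ps₁ ps₂ : List (Pair t)} {F₁ F₂ : List (Fin t)} {u₁ u₂ : ℕ} →
    Unique (points (ps₁ ++ ps₂) ++ F₁ ++ F₂) →
    (Unique (points ps₁ ++ F₁) → Round ps₁ F₁ u₁) →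
    (Unique (points ps₂ ++ F₂) → Round ps₂ F₂ u₂) →
    Round (ps₁ ++ ps₂) (F₁ ++ F₂) (u₁ + u₂)
  combine {ps₁} {ps₂} {F₁} {F₂} {u₁} {u₂} unique₁₂ round₁ round₂ = record
    { γs = R₁.γs ++ R₂.γs
    ; γs-even = even-++ R₁.γs-even R₂.γs-even
    ; qs = R₁.qs ++ R₂.qs
    ; F′ = R₁.F′ ++ R₂.F′
    ; commutator = λ x → trans
        (⟦⟧-prodTransp-disjoint ps₁ R₁.γs ps₂ R₂.γs (Subset.xs⊆xs++ys _ F₁) R₁.γs-inside
                                                    (Subset.xs⊆xs++ys _ F₂) R₂.γs-inside W₁#W₂ x)
        (trans (·-cong {⟦ prodTransp ps₁ , prodTransp R₁.γs ⟧} {prodTransp R₁.qs}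
                       {⟦ prodTransp ps₂ , prodTransp R₂.γs ⟧} {prodTransp R₂.qs}
                       R₁.commutator R₂.commutator x)
               (sym (prodTransp-++ R₁.qs R₂.qs x)))
    ; qs-length = trans (length-++ R₁.qs)
        (trans (sum-of-sums (length ps₁) u₁ (length ps₂) u₂ R₁.qs-length R₂.qs-length) (cong (_+ (u₁ + u₂)) (sym (length-++ ps₁))))
    ; F-length = trans (length-++ F₁)
        (trans (sum-of-sums (u₁ * 2) (length R₁.F′) (u₂ * 2) (length R₂.F′) R₁.F-length R₂.F-length)
               (cong₂ _+_ (sym (*-distribʳ-+ 2 u₁ u₂)) (sym (length-++ R₁.F′))))
    ; unique = Unique-↭ (↭-sym (layout R₁.qs R₂.qs R₁.F′ R₂.F′))
        (Unique.++⁺ R₁.unique R₂.unique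
          (λ (v∈₁ , v∈₂) → W₁#W₂ (R₁.result-inside v∈₁ , R₂.result-inside v∈₂)))
    ; γs-inside = ↭.∈-resp-↭ (↭-sym (layout ps₁ ps₂ F₁ F₂))
        ∘ Subset.++⁺ R₁.γs-inside R₂.γs-inside
        ∘ subst (_ ∈_) (points-++ R₁.γs R₂.γs)
    ; result-inside = ↭.∈-resp-↭ (↭-sym (layout ps₁ ps₂ F₁ F₂))
        ∘ Subset.++⁺ R₁.result-inside R₂.result-inside
        ∘ ↭.∈-resp-↭ (layout R₁.qs R₂.qs R₁.F′ R₂.F′)
    }
    where
    W₁ = points ps₁ ++ F₁
    W₂ = points ps₂ ++ F₂
    split = Unique-++⁻ W₁ (Unique-↭ (layout ps₁ ps₂ F₁ F₂) unique₁₂)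
    W₁#W₂ : Disjoint W₁ W₂
    W₁#W₂ = proj₂ (proj₂ split)
    module R₁ = Round (round₁ (proj₁ split))
    module R₂ = Round (round₂ (proj₁ (proj₂ split)))

  -- A full round on (ps, F): the first u transpositions of ps are doubled
  -- with 2u fresh points of F, the remaining 2s are kept in pairs.
  round : (u s : ℕ) (ps : List (Pair t)) (F : List (Fin t)) →
    length ps ≡ u + s * 2 → u * 2 ≤ length F → Unique (points ps ++ F) → Round ps F u
  round zero zero [] F _ _ unique = idle-round F unique
  round zero (suc s) ((x , y) ∷ (z , w) ∷ ps) F len _ unique =
    combine unique (keep-round x y z w) (round zero s ps F (suc-injective (suc-injective len)) z≤n)
  round (suc u) s ((p , q) ∷ ps) (f ∷ g ∷ F) len (s≤s (s≤s room)) unique =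
    combine unique (double-round p q f g) (round u s ps F (suc-injective len) room)
  round zero zero (_ ∷ _) _ () _ _
  round zero (suc s) [] _ () _ _
  round zero (suc s) (_ ∷ []) _ () _ _
  round (suc u) s [] _ () _ _
  round (suc u) s (_ ∷ _) [] _ () _
  round (suc u) s (_ ∷ _) (_ ∷ []) _ (s≤s ()) _

  disjoint-product : (ps : List (Pair t)) → Unique (points ps) → IsDisjTranspProd (length ps) (prodTransp ps)
  disjoint-product ps unique-ps =
    V.fromList ps ,
    subst (λ L → Unique (points L) × prodTransp ps ≈ prodTransp L) (sym (toList∘fromList ps))
          (unique-ps , λ _ → refl)

  -- Each round doubles d = min(h, l ∸ h) pairs and keeps the others.
  iterate : (m h l : ℕ) (ps : List (Pair t)) (F : List (Fin t)) → Unique (points ps ++ F) →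
    length ps ≡ h * 2 → h ≤ l → l ≤ 2 ^ m * h → l * 4 ≤ h * 4 + length F →
    Σ (Vec (Perm t) m) λ γs → All IsEvenPerm γs × IsDisjTranspProd (l * 2) (iterComm (prodTransp ps) γs)
  iterate zero h l ps F unique-state len h≤l l≤h _ =
    V.[] , [] ,
    subst (λ k → IsDisjTranspProd k (prodTransp ps)) (trans len (cong (_* 2) h≡l))
          (disjoint-product ps (proj₁ (Unique-++⁻ (points ps) unique-state)))
    where
    h≡l : h ≡ l
    h≡l = ≤-antisym h≤l (subst (l ≤_) (*-identityˡ h) l≤h)
  iterate (suc m) h l ps F unique-state len h≤l l≤2^[1+m]h budget =
    γ V.∷ γs′ , even-perm R.γs-even ∷ proj₁ (proj₂ rest) ,
    IsDisjTranspProd-resp {l * 2} {iterComm ⟦ prodTransp ps , γ ⟧ γs′} {iterComm (prodTransp R.qs) γs′}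
      (iterComm-cong γs′ R.commutator) (proj₂ (proj₂ rest))
    where
    d = h ⊓ (l ∸ h)

    h+d≤l : h + d ≤ l
    h+d≤l = subst (h + d ≤_) (m+[n∸m]≡n h≤l) (+-monoʳ-≤ h (m⊓n≤n h (l ∸ h)))

    module R = Round (round (d * 2) (h ∸ d) ps F (trans len (split-pairs (m⊓n≤m h (l ∸ h))))
                            (budget-room {h} {d} h+d≤l budget) unique-state)

    qs-length : length R.qs ≡ (h + d) * 2
    qs-length = trans R.qs-length (trans (cong (_+ d * 2) len) (sym (*-distribʳ-+ 2 h d)))

    rest = iterate m (h + d) l R.qs R.F′ R.unique qs-length h+d≤l
                   (doubling-bound m h≤l l≤2^[1+m]h) (budget-next {h} {d} {l} budget R.F-length)
    γ = prodTransp R.γs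
    γs′ = proj₁ rest

  remove : Fin t → List (Fin t) → List (Fin t)
  remove x = filter (λ y → ¬? (y ≟ x))

  length-remove : {x : Fin t} {ys : List (Fin t)} → Unique ys → x ∈ ys →
    length ys ≡ suc (length (remove x ys))
  length-remove {x} {_ ∷ ys} (x∉ys ∷ _) (here refl) = cong suc (sym (cong length (begin
    remove x (x ∷ ys) ≡⟨ filter-reject (λ y → ¬? (y ≟ x)) (λ x≢x → x≢x refl) ⟩
    remove x ys       ≡⟨ filter-all (λ y → ¬? (y ≟ x)) (ListAll.map (_∘ sym) x∉ys) ⟩
    ys                ∎)))
    where open ≡-Reasoning
  length-remove {x} {y ∷ ys} (y∉ys ∷ unique) (there x∈ys) =
    trans (cong suc (length-remove unique x∈ys))
          (cong (suc ∘ length) (sym (filter-accept (λ z → ¬? (z ≟ x)) {y} (ListAll.lookup y∉ys x∈ys))))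

  removeAll : List (Fin t) → List (Fin t) → List (Fin t)
  removeAll [] ys = ys
  removeAll (x ∷ xs) ys = remove x (removeAll xs ys)

  removeAll-unique : (xs : List (Fin t)) {ys : List (Fin t)} → Unique ys → Unique (removeAll xs ys)
  removeAll-unique [] unique = unique
  removeAll-unique (x ∷ xs) unique = Unique.filter⁺ (λ y → ¬? (y ≟ x)) (removeAll-unique xs unique)

  ∈-removeAll : (xs : List (Fin t)) {ys : List (Fin t)} {y : Fin t} → y ∈ ys → y ∉ xs → y ∈ removeAll xs ys
  ∈-removeAll [] y∈ys _ = y∈ys
  ∈-removeAll (x ∷ xs) y∈ys y∉ = ∈-filter⁺ (λ y → ¬? (y ≟ x)) (∈-removeAll xs y∈ys (y∉ ∘ there)) (y∉ ∘ here)

  ∉-removeAll : (xs : List (Fin t)) {ys : List (Fin t)} {y : Fin t} → y ∈ removeAll xs ys → y ∉ xs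
  ∉-removeAll (x ∷ xs) {ys} y∈ (here y≡x) = proj₂ (∈-filter⁻ (λ y → ¬? (y ≟ x)) {xs = removeAll xs ys} y∈) y≡x
  ∉-removeAll (x ∷ xs) {ys} y∈ (there y∈xs) =
    ∉-removeAll xs (proj₁ (∈-filter⁻ (λ y → ¬? (y ≟ x)) {xs = removeAll xs ys} y∈)) y∈xs

  length-removeAll : {xs ys : List (Fin t)} → Unique xs → Unique ys → xs ⊆ ys →
    length ys ≡ length xs + length (removeAll xs ys)
  length-removeAll {[]} _ _ _ = refl
  length-removeAll {x ∷ xs} {ys} (x∉xs ∷ unique-xs) unique-ys x∷xs⊆ys = begin
    length ys                                        ≡⟨ length-removeAll unique-xs unique-ys (x∷xs⊆ys ∘ there) ⟩
    length xs + length (removeAll xs ys)             ≡⟨ cong (length xs +_) (length-remove (removeAll-unique xs unique-ys) x∈rest) ⟩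
    length xs + suc (length (removeAll (x ∷ xs) ys)) ≡⟨ +-suc (length xs) _ ⟩
    suc (length xs + length (removeAll (x ∷ xs) ys)) ∎
    where
    open ≡-Reasoning
    x∈rest : x ∈ removeAll xs ys
    x∈rest = ∈-removeAll xs (x∷xs⊆ys (here refl)) (λ x∈xs → ListAll.lookup x∉xs x∈xs refl)

  free-points : (xs : List (Fin t)) → Unique xs →
    Σ (List (Fin t)) λ F → Unique (xs ++ F) × t ≡ length xs + length F
  free-points xs unique-xs =
    removeAll xs (allFin t) ,
    Unique.++⁺ unique-xs (removeAll-unique xs (Unique.allFin⁺ t)) (λ (y∈xs , y∈F) → ∉-removeAll xs y∈F y∈xs) ,
    trans (sym (length-tabulate (λ x → x)))
          (length-removeAll unique-xs (Unique.allFin⁺ t) (λ {x} _ → ∈-allFin x))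

-- Starting from h = 1 pair with the
-- t ∸ 4 remaining points free, ⌈log₂ k⌉ rounds reach l = q pairs: q ≤ k ≤
-- 2^⌈log₂ k⌉, and the 4(q ∸ 1) fresh points needed exist because 2k ≤ t.
lemma2p4 : (t : ℕ) (α : Perm t) → IsEvenPerm α → IsDoubleTransposition α →
    (k : ℕ) → 2 ∣ k → 2 ≤ k → 2 * k ≤ t →
    Σ (Vec (Perm t) ⌈log₂ k ⌉) λ γs →
      All IsEvenPerm γs × IsDisjTranspProd k (iterComm α γs)
lemma2p4 t α _ ((p₁ V.∷ p₂ V.∷ V.[]) , unique-α , α≈) k (divides q k≡q*2) 2≤k 2k≤t =
  γs , evens ,
  IsDisjTranspProd-resp {σ = iterComm α γs} {τ = iterComm (prodTransp ps) γs} (iterComm-cong γs α≈)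
    (subst (λ n → IsDisjTranspProd n (iterComm (prodTransp ps) γs)) (sym k≡q*2) disjoint)
  where
  ps = p₁ ∷ p₂ ∷ []
  free = free-points (points ps) unique-α
  F = proj₁ free

  q≤2^⌈log₂k⌉ : q ≤ 2 ^ ⌈log₂ k ⌉ * 1
  q≤2^⌈log₂k⌉ = subst (q ≤_) (sym (*-identityʳ _))
    (≤-trans (m≤m*n q 2) (subst (_≤ 2 ^ ⌈log₂ k ⌉) k≡q*2 (n≤2^⌈log₂n⌉ k)))

  budget : q * 4 ≤ 1 * 4 + length F
  budget = subst₂ _≤_ (trans (*-comm 2 k) (trans (cong (_* 2) k≡q*2) (*-assoc q 2 2)))
                      (proj₂ (proj₂ free)) 2k≤t

  result = iterate ⌈log₂ k ⌉ 1 q ps F (proj₁ (proj₂ free)) refl (half-positive k≡q*2 2≤k)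
                   q≤2^⌈log₂k⌉ budget
  γs = proj₁ result
  evens = proj₁ (proj₂ result)
  disjoint = proj₂ (proj₂ result)
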